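{- For every integer $n\ge 1$, the path $P_n$ on $n$ vertices satisfies $$\mathrm{avg}_1(P_n) = 1 + 2\cdot 3^{ -n+1} \sum_{k=0}^{n-1} k \sum_{i=0}^{\lfloor \frac{n-1-k}{2}\rfloor}\left( \binom{n-1}{k+i}\binom{n-k-i-1}{i} + \binom{n-1}{k+1+i}\binom{n-k-i-2}{i}\right),$$ where $\binom{a}{b}$ is taken to be $0$ whenever $b>a$.
   Context: Let $G=(V,E)$ be a finite connected graph with a fixed root $v_0$. A $1$-Lipschitz mapping of $G$ is a map $f:V\to\mathbb{Z}$ with $f(v_0)=0$ and $|f(u)-f(v)|\le 1$ for every edge $uv$; the set of these is $\mathcal{L}_1(G)$. The range of $f$ is $\mathrm{rng}(f)=|\{f(v):v\in V\}|$, and $\mathrm{avg}_1(G)=\frac{\sum_{f\in\mathcal{L}_1(G)}\mathrm{rng}(f)}{|\mathcal{L}_1(G)|}$ (independent of the root; e.g. root $P_n$ at an endpoint). -}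

module Defs where

open import Data.Nat using (ℕ; zero; suc; _+_; _*_; _∸_; _^_; _≤_; ⌊_/2⌋)
open import Data.Nat.Combinatorics using (_C_)
open import Data.Integer as ℤ using (ℤ; +_; ∣_∣; _-_)
open import Data.Fin using (Fin; zero; suc; inject₁)
open import Data.Nat.ListAction using (sum)
open import Data.List using (List; map; upTo; length; allFin; deduplicate)
open import Data.List.Relation.Unary.All using (All)
open import Data.List.Relation.Unary.Any using (Any)
open import Data.List.Relation.Unary.AllPairs using (AllPairs)
open import Data.Product using (_×_)
open import Relation.Binary.PropositionalEquality using (_≡_)
open import Relation.Nullary using (¬_)

-- The path P_{suc m} (so n = suc m ≥ 1 vertices): vertex set Fin (suc m),
-- edges {inject₁ i , suc i} for i : Fin m, i.e. {j, j+1}.  Root v₀ = zero (an endpoint).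

IsLip1 : (m : ℕ) → (Fin (suc m) → ℤ) → Set
IsLip1 m f = (f zero ≡ + 0) × (∀ (i : Fin m) → ∣ f (inject₁ i) - f (suc i) ∣ ≤ 1)

rng : (m : ℕ) → (Fin (suc m) → ℤ) → ℕ
rng m f = length (deduplicate ℤ._≟_ (map f (allFin (suc m))))

_≗f_ : ∀ {m} → (Fin (suc m) → ℤ) → (Fin (suc m) → ℤ) → Set
f ≗f g = ∀ i → f i ≡ g i

Enumerates : (m : ℕ) → List (Fin (suc m) → ℤ) → Set
Enumerates m L =
  All (IsLip1 m) L
  × (∀ f → IsLip1 m f → Any (λ g → f ≗f g) L)
  × AllPairs (λ f g → ¬ (f ≗f g)) L

sumUpTo : ℕ → (ℕ → ℕ) → ℕ
sumUpTo b g = sum (map g (upTo (suc b)))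

-- S(n) = Σ_{k=0}^{n-1} k Σ_{i=0}^{⌊(n-1-k)/2⌋} ( C(n-1,k+i) C(n-k-i-1,i) + C(n-1,k+1+i) C(n-k-i-2,i) )
-- with n = suc m, so n-1 = m.  (When n-k-i-2 = -1 the first factor C(m, m+1) is 0.)
S : ℕ → ℕ
S m = sumUpTo m (λ k → k * sumUpTo ⌊ (m ∸ k) /2⌋ (λ i →
        (m C (k + i)) * ((m ∸ k ∸ i) C i)
        + (m C (k + 1 + i)) * ((m ∸ k ∸ i ∸ 1) C i)))

-- A 1-Lipschitz map on the path, rooted at an endpoint, is the height profile of a walk
-- with steps +1, 0, -1; so there are 3^m of them, and the range of such a map is
-- 1 + (peak of the walk) + (depth of its trough).  Mirroring a walk exchanges peak and
-- trough, so it remains to see that the peaks of all walks add up to S m.  The inner sum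
-- of S counts the walks with peak k; this is proved by showing that both satisfy the
-- same recursion in the number of steps.

module Submission where

open import Function using (_∘_)
open import Function.Bundles using (mk⇔)
open import Algebra.Bundles using (AbelianGroup)
open import Data.Nat
  using (ℕ; zero; suc; pred; _+_; _*_; _∸_; _^_; _≤_; _<_; _≤?_; _<?_; z≤n; s≤s; ⌊_/2⌋)
open import Data.Nat.Properties
  using ( +-assoc; +-comm; +-suc; +-identityʳ; *-identityʳ; *-zeroʳ; *-distribˡ-+; *-distribʳ-+
        ; +-∸-assoc; ∸-+-assoc; m+n∸m≡n; m∸n≤m; m≤n+m∸n; ∸-monoˡ-<; ⌊n/2⌋≤n
        ; ≤-trans; ≤-<-trans; ≤-pred; n≤1+n; m≤m+n; m≤n+m; m<n⇒m<1+n; +-monoˡ-≤; +-monoʳ-<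
        ; pred-mono-≤; ≮⇒≥; ≰⇒>; +-commutativeSemigroup)
open import Algebra.Properties.CommutativeSemigroup +-commutativeSemigroup
  using (interchange; x∙yz≈y∙xz; xy∙z≈zy∙x)
open import Data.Nat.Combinatorics using (_C_; nCk+nC[k+1]≡[n+1]C[k+1]; k>n⇒nCk≡0)
open import Data.Nat.ListAction using (sum)
open import Data.Nat.ListAction.Properties using (sum-++; sum-↭)
open import Data.Nat.Tactic.RingSolver using (solve-∀)
open import Data.Integer as ℤ using (ℤ; +0; +[1+_]; -[1+_]; ∣_∣; _-_)
import Data.Integer.Properties as ℤP
open import Data.Integer.Tactic.RingSolver renaming (solve-∀ to ℤ-solve-∀)
open import Algebra.Properties.Group (AbelianGroup.group ℤP.+-0-abelianGroup) using (∙-cancelˡ)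
open import Data.Fin using (Fin; zero; suc; inject₁)
open import Data.Vec using (Vec; []; _∷_; tabulate; lookup)
open import Data.Vec.Properties using (∷-injective; lookup∘tabulate; tabulate-cong)
open import Data.List
  using (List; []; _∷_; [_]; map; _++_; length; applyUpTo; upTo; allFin; deduplicate; cartesianProductWith)
open import Data.List.Properties using (map-++; map-∘; map-cong; length-++; length-map; length-upTo)
open import Data.List.Membership.Propositional using (_∈_)
open import Data.List.Membership.Propositional.Properties
  using ( ∈-cartesianProductWith⁺; ∈-map⁺; ∈-map⁻; ∈-++⁺ˡ; ∈-++⁺ʳ; ∈-++⁻; ∈-upTo⁺; ∈-upTo⁻
        ; ∈-allFin; ∈-deduplicate⁺; ∈-deduplicate⁻)
open import Data.List.Membership.Propositional.Properties.WithK using (unique∧set⇒bag)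
open import Data.List.Relation.Binary.BagAndSetEquality using (∼bag⇒↭)
open import Data.List.Relation.Binary.Disjoint.Propositional using (Disjoint)
open import Data.List.Relation.Binary.Permutation.Propositional using (_↭_)
import Data.List.Relation.Binary.Permutation.Propositional.Properties as ↭
import Data.List.Relation.Unary.All as All
import Data.List.Relation.Unary.All.Properties as All
import Data.List.Relation.Unary.Any as Any
import Data.List.Relation.Unary.Any.Properties as Any
import Data.List.Relation.Unary.AllPairs as AllPairs
import Data.List.Relation.Unary.AllPairs.Properties as AllPairs
open import Data.List.Relation.Unary.Any using (here; there)
open import Data.List.Relation.Unary.AllPairs using ([]; _∷_)
open import Data.List.Relation.Unary.All using ([]; _∷_)
open import Data.List.Relation.Unary.Unique.Propositional using (Unique)
import Data.List.Relation.Unary.Unique.Propositional.Properties as Unique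
open import Data.List.Relation.Unary.Unique.DecPropositional.Properties using (deduplicate-!)
open import Data.Product using (∃; _,_; _×_)
open import Data.Sum using (inj₁; inj₂)
open import Relation.Nullary using (yes; no)
open import Relation.Binary.PropositionalEquality
  using (_≡_; refl; sym; trans; cong; cong₂; subst; module ≡-Reasoning)
open ≡-Reasoning

open import Defs

-- Finite sums

sumBelow : ℕ → (ℕ → ℕ) → ℕ
sumBelow zero    F = 0
sumBelow (suc n) F = F 0 + sumBelow n (F ∘ suc)

sumBelow-cong : ∀ n {F G : ℕ → ℕ} → (∀ i → F i ≡ G i) → sumBelow n F ≡ sumBelow n G
sumBelow-cong zero    F≗G = refl
sumBelow-cong (suc n) F≗G = cong₂ _+_ (F≗G 0) (sumBelow-cong n (F≗G ∘ suc))

sumBelow-distrib-+ : ∀ n (F G : ℕ → ℕ) →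
  sumBelow n (λ i → F i + G i) ≡ sumBelow n F + sumBelow n G
sumBelow-distrib-+ zero    F G = refl
sumBelow-distrib-+ (suc n) F G = begin
  F 0 + G 0 + sumBelow n (λ i → F (suc i) + G (suc i))
    ≡⟨ cong (F 0 + G 0 +_) (sumBelow-distrib-+ n (F ∘ suc) (G ∘ suc)) ⟩
  F 0 + G 0 + (sumBelow n (F ∘ suc) + sumBelow n (G ∘ suc))
    ≡⟨ interchange (F 0) (G 0) _ _ ⟩
  F 0 + sumBelow n (F ∘ suc) + (G 0 + sumBelow n (G ∘ suc)) ∎

sumBelow-distrib-+₃ : ∀ n (F G H : ℕ → ℕ) →
  sumBelow n (λ i → F i + G i + H i) ≡ sumBelow n F + sumBelow n G + sumBelow n H
sumBelow-distrib-+₃ n F G H = begin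
  sumBelow n (λ i → F i + G i + H i)
    ≡⟨ sumBelow-distrib-+ n (λ i → F i + G i) H ⟩
  sumBelow n (λ i → F i + G i) + sumBelow n H
    ≡⟨ cong (_+ sumBelow n H) (sumBelow-distrib-+ n F G) ⟩
  sumBelow n F + sumBelow n G + sumBelow n H ∎

sumBelow-truncate : ∀ {n n′} (F : ℕ → ℕ) → n ≤ n′ → (∀ i → n ≤ i → F i ≡ 0) →
  sumBelow n′ F ≡ sumBelow n F
sumBelow-truncate {n′ = zero}  F z≤n _   = refl
sumBelow-truncate {n′ = suc n′} F z≤n F≡0 =
  cong₂ _+_ (F≡0 0 z≤n) (sumBelow-truncate {n′ = n′} (F ∘ suc) z≤n (λ i _ → F≡0 (suc i) z≤n))
sumBelow-truncate F (s≤s n≤n′) F≡0 =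
  cong (F 0 +_) (sumBelow-truncate (F ∘ suc) n≤n′ (λ i n≤i → F≡0 (suc i) (s≤s n≤i)))

sumUpTo≡sumBelow : ∀ b F → sumUpTo b F ≡ sumBelow (suc b) F
sumUpTo≡sumBelow b F = sum-map-applyUpTo (suc b) (λ i → i)
  where
  sum-map-applyUpTo : ∀ n (f : ℕ → ℕ) → sum (map F (applyUpTo f n)) ≡ sumBelow n (F ∘ f)
  sum-map-applyUpTo zero    f = refl
  sum-map-applyUpTo (suc n) f = cong (F (f 0) +_) (sum-map-applyUpTo n (f ∘ suc))

-- Counting walks by endpoint and by peak

trinomial : ℕ → ℕ → ℕ → ℕ
trinomial m u d = (m C u) * ((m ∸ u) C d)

trinomial-vanish : ∀ {m u} d → m < u + d → trinomial m u d ≡ 0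
trinomial-vanish {m} {u} d m<u+d with u ≤? m
... | no u≰m rewrite k>n⇒nCk≡0 (≰⇒> u≰m) = refl
... | yes u≤m = trans (cong ((m C u) *_) (k>n⇒nCk≡0 m∸u<d)) (*-zeroʳ (m C u))
  where
  m∸u<d : m ∸ u < d
  m∸u<d = subst (m ∸ u <_) (m+n∸m≡n u d) (∸-monoˡ-< m<u+d u≤m)

trinomial[1+m,0,1+d] : ∀ m d →
  trinomial (suc m) 0 (suc d) ≡ trinomial m 0 d + trinomial m 0 (suc d)
trinomial[1+m,0,1+d] m d = begin
  1 * (suc m C suc d)             ≡⟨ cong (1 *_) (nCk+nC[k+1]≡[n+1]C[k+1] m d) ⟨
  1 * (m C d + m C suc d)         ≡⟨ *-distribˡ-+ 1 (m C d) (m C suc d) ⟩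
  1 * (m C d) + 1 * (m C suc d)   ∎

trinomial[1+m,1+u,0] : ∀ m u →
  trinomial (suc m) (suc u) 0 ≡ trinomial m u 0 + trinomial m (suc u) 0
trinomial[1+m,1+u,0] m u = begin
  (suc m C suc u) * 1             ≡⟨ cong (_* 1) (nCk+nC[k+1]≡[n+1]C[k+1] m u) ⟨
  (m C u + m C suc u) * 1         ≡⟨ *-distribʳ-+ 1 (m C u) (m C suc u) ⟩
  (m C u) * 1 + (m C suc u) * 1   ∎

trinomial[1+m,1+u,1+d] : ∀ m u d →
  trinomial (suc m) (suc u) (suc d)
    ≡ trinomial m u (suc d) + trinomial m (suc u) d + trinomial m (suc u) (suc d)
trinomial[1+m,1+u,1+d] m u d = begin
  (suc m C suc u) * ((m ∸ u) C suc d)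
    ≡⟨ cong (_* ((m ∸ u) C suc d)) (nCk+nC[k+1]≡[n+1]C[k+1] m u) ⟨
  (m C u + m C suc u) * ((m ∸ u) C suc d)
    ≡⟨ *-distribʳ-+ ((m ∸ u) C suc d) (m C u) (m C suc u) ⟩
  trinomial m u (suc d) + (m C suc u) * ((m ∸ u) C suc d)
    ≡⟨ cong (trinomial m u (suc d) +_) pascal-on-downs ⟩
  trinomial m u (suc d) + (trinomial m (suc u) d + trinomial m (suc u) (suc d))
    ≡⟨ +-assoc (trinomial m u (suc d)) _ _ ⟨
  trinomial m u (suc d) + trinomial m (suc u) d + trinomial m (suc u) (suc d) ∎
  where
  pascal-on-downs : (m C suc u) * ((m ∸ u) C suc d)
                          ≡ trinomial m (suc u) d + trinomial m (suc u) (suc d)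
  pascal-on-downs with u <? m
  ... | yes u<m rewrite +-∸-assoc 1 u<m =
    trans (cong ((m C suc u) *_) (sym (nCk+nC[k+1]≡[n+1]C[k+1] (m ∸ suc u) d)))
          (*-distribˡ-+ (m C suc u) ((m ∸ suc u) C d) ((m ∸ suc u) C suc d))
  ... | no u≮m rewrite k>n⇒nCk≡0 (s≤s (≮⇒≥ u≮m)) = refl

trinomial-sym : ∀ m u d → trinomial m u d ≡ trinomial m d u
trinomial-sym m       zero    zero    = refl
trinomial-sym zero    zero    (suc d) = refl
trinomial-sym zero    (suc u) zero    = refl
trinomial-sym zero    (suc u) (suc d) = refl
trinomial-sym (suc m) zero    (suc d) = begin
  trinomial (suc m) 0 (suc d)              ≡⟨ trinomial[1+m,0,1+d] m d ⟩
  trinomial m 0 d + trinomial m 0 (suc d)  ≡⟨ cong₂ _+_ (trinomial-sym m 0 d) (trinomial-sym m 0 (suc d)) ⟩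
  trinomial m d 0 + trinomial m (suc d) 0  ≡⟨ trinomial[1+m,1+u,0] m d ⟨
  trinomial (suc m) (suc d) 0              ∎
trinomial-sym (suc m) (suc u) zero    = begin
  trinomial (suc m) (suc u) 0              ≡⟨ trinomial[1+m,1+u,0] m u ⟩
  trinomial m u 0 + trinomial m (suc u) 0  ≡⟨ cong₂ _+_ (trinomial-sym m u 0) (trinomial-sym m (suc u) 0) ⟩
  trinomial m 0 u + trinomial m 0 (suc u)  ≡⟨ trinomial[1+m,0,1+d] m u ⟨
  trinomial (suc m) 0 (suc u)              ∎
trinomial-sym (suc m) (suc u) (suc d) = begin
  trinomial (suc m) (suc u) (suc d)
    ≡⟨ trinomial[1+m,1+u,1+d] m u d ⟩
  trinomial m u (suc d) + trinomial m (suc u) d + trinomial m (suc u) (suc d)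
    ≡⟨ cong₂ _+_ (cong₂ _+_ (trinomial-sym m u (suc d)) (trinomial-sym m (suc u) d))
                 (trinomial-sym m (suc u) (suc d)) ⟩
  trinomial m (suc d) u + trinomial m d (suc u) + trinomial m (suc d) (suc u)
    ≡⟨ cong (_+ trinomial m (suc d) (suc u)) (+-comm (trinomial m (suc d) u) _) ⟩
  trinomial m d (suc u) + trinomial m (suc d) u + trinomial m (suc d) (suc u)
    ≡⟨ trinomial[1+m,1+u,1+d] m d u ⟨
  trinomial (suc m) (suc d) (suc u) ∎

-- A walk of m steps with u up-steps and d down-steps can be chosen in trinomial m u d
-- ways, so endCount m j is the number of walks of m steps ending at height j.
endCount : ℕ → ℕ → ℕ
endCount m j = sumBelow (suc m) (λ i → trinomial m (j + i) i)

endCount-widen : ∀ {m n} j → suc m ≤ n →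
  sumBelow n (λ i → trinomial m (j + i) i) ≡ endCount m j
endCount-widen {m} j m<n = sumBelow-truncate _ m<n
  (λ i m<i → trinomial-vanish i (≤-trans m<i (m≤n+m i (j + i))))

endCount-vanish : ∀ {m j} → m < j → endCount m j ≡ 0
endCount-vanish {m} {j} m<j = sumBelow-truncate {n = 0} {n′ = suc m} _ z≤n
  (λ i _ → trinomial-vanish i (≤-trans m<j (≤-trans (m≤m+n j i) (m≤m+n (j + i) i))))

endCount[1+m,1+j] : ∀ m j →
  endCount (suc m) (suc j) ≡ endCount m j + endCount m (suc j) + endCount m (suc (suc j))
endCount[1+m,1+j] m j = begin
  endCount (suc m) (suc j)
    ≡⟨ cong₂ _+_ (trinomial[1+m,1+u,0] m (j + 0))
                 (sumBelow-cong (suc m) (λ i → trinomial[1+m,1+u,1+d] m (j + suc i) i)) ⟩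
  (P₀ + R₀) + sumBelow (suc m) (λ i → P i + Q i + R i)
    ≡⟨ cong (P₀ + R₀ +_) (sumBelow-distrib-+₃ (suc m) P Q R) ⟩
  (P₀ + R₀) + (sumBelow (suc m) P + sumBelow (suc m) Q + sumBelow (suc m) R)
    ≡⟨ regroup P₀ R₀ (sumBelow (suc m) P) (sumBelow (suc m) Q) (sumBelow (suc m) R) ⟩
  (P₀ + sumBelow (suc m) P) + (R₀ + sumBelow (suc m) R) + sumBelow (suc m) Q
    ≡⟨ cong₂ _+_ (cong₂ _+_ (endCount-widen {m} j (n≤1+n _)) (endCount-widen {m} (suc j) (n≤1+n _)))
                 (sumBelow-cong (suc m) (λ i → cong (λ x → trinomial m (suc x) i) (+-suc j i))) ⟩
  endCount m j + endCount m (suc j) + endCount m (suc (suc j)) ∎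
  where
  P₀ R₀ : ℕ
  P₀ = trinomial m (j + 0) 0
  R₀ = trinomial m (suc (j + 0)) 0
  P Q R : ℕ → ℕ
  P i = trinomial m (j + suc i) (suc i)
  Q i = trinomial m (suc (j + suc i)) i
  R i = trinomial m (suc (j + suc i)) (suc i)
  regroup : ∀ a b p q r → (a + b) + (p + q + r) ≡ (a + p) + (b + r) + q
  regroup = solve-∀

endCount[1+m,0] : ∀ m → endCount (suc m) 0 ≡ endCount m 0 + endCount m 1 + endCount m 1
endCount[1+m,0] m = begin
  endCount (suc m) 0
    ≡⟨ cong (1 +_) (sumBelow-cong (suc m) (λ i → trinomial[1+m,1+u,1+d] m i i)) ⟩
  1 + sumBelow (suc m) (λ i → P i + Q i + R i)
    ≡⟨ cong (1 +_) (sumBelow-distrib-+₃ (suc m) P Q R) ⟩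
  1 + (sumBelow (suc m) P + sumBelow (suc m) Q + sumBelow (suc m) R)
    ≡⟨ regroup (sumBelow (suc m) P) (sumBelow (suc m) Q) (sumBelow (suc m) R) ⟩
  (1 + sumBelow (suc m) R) + sumBelow (suc m) Q + sumBelow (suc m) P
    ≡⟨ cong₂ _+_ (cong (_+ sumBelow (suc m) Q) (endCount-widen {m} 0 (n≤1+n (suc m))))
                 (sumBelow-cong (suc m) (λ i → trinomial-sym m i (suc i))) ⟩
  endCount m 0 + endCount m 1 + endCount m 1 ∎
  where
  P Q R : ℕ → ℕ
  P i = trinomial m i (suc i)
  Q i = trinomial m (suc i) i
  R i = trinomial m (suc i) (suc i)
  regroup : ∀ p q r → 1 + (p + q + r) ≡ (1 + r) + q + p
  regroup = solve-∀

-- Reflection principle: walks with peak ≥ k are as many as walks ending at ≥ k plus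
-- walks ending at ≥ k + 1, so peakCount m k counts the walks of m steps with peak k.
peakCount : ℕ → ℕ → ℕ
peakCount m k = endCount m k + endCount m (suc k)

peakCount-vanish : ∀ {m k} → m < k → peakCount m k ≡ 0
peakCount-vanish m<k = cong₂ _+_ (endCount-vanish m<k) (endCount-vanish (m<n⇒m<1+n m<k))

peakCount[1+m,1+k] : ∀ m k →
  peakCount (suc m) (suc k) ≡ peakCount m k + peakCount m (suc k) + peakCount m (suc (suc k))
peakCount[1+m,1+k] m k = begin
  endCount (suc m) (suc k) + endCount (suc m) (suc (suc k))
    ≡⟨ cong₂ _+_ (endCount[1+m,1+j] m k) (endCount[1+m,1+j] m (suc k)) ⟩
  a + b + c + (b + c + d)
    ≡⟨ regroup a b c d ⟩
  a + b + (b + c) + (c + d) ∎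
  where
  a = endCount m k
  b = endCount m (suc k)
  c = endCount m (suc (suc k))
  d = endCount m (suc (suc (suc k)))
  regroup : ∀ a b c d → a + b + c + (b + c + d) ≡ a + b + (b + c) + (c + d)
  regroup = solve-∀

peakCount[1+m,0] : ∀ m → peakCount (suc m) 0 ≡ peakCount m 0 + peakCount m 0 + peakCount m 1
peakCount[1+m,0] m = begin
  endCount (suc m) 0 + endCount (suc m) 1
    ≡⟨ cong₂ _+_ (endCount[1+m,0] m) (endCount[1+m,1+j] m 0) ⟩
  a + b + b + (a + b + c)
    ≡⟨ regroup a b c ⟩
  a + b + (a + b) + (b + c) ∎
  where
  a = endCount m 0
  b = endCount m 1
  c = endCount m 2
  regroup : ∀ a b c → a + b + b + (a + b + c) ≡ a + b + (a + b) + (b + c)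
  regroup = solve-∀

sumByPeak : ℕ → (ℕ → ℕ) → ℕ
sumByPeak m g = sumBelow (suc m) (λ k → g k * peakCount m k)

sumByPeak-widen : ∀ {m n} (g : ℕ → ℕ) → suc m ≤ n →
  sumBelow n (λ k → g k * peakCount m k) ≡ sumByPeak m g
sumByPeak-widen g m<n = sumBelow-truncate _ m<n
  (λ k m<k → trans (cong (g k *_) (peakCount-vanish m<k)) (*-zeroʳ (g k)))

-- The three sums on the right are those over walks starting with an up-, flat and
-- down-step, whose peaks are 1 + p, p and pred p in terms of the peak p of the rest.
sumByPeak-suc : ∀ m g →
  sumByPeak (suc m) g ≡ sumByPeak m (g ∘ suc) + sumByPeak m g + sumByPeak m (g ∘ pred)
sumByPeak-suc m g = begin
  sumByPeak (suc m) g
    ≡⟨ cong₂ _+_ (cong (g 0 *_) (peakCount[1+m,0] m))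
                 (sumBelow-cong (suc m) (λ k → cong (g (suc k) *_) (peakCount[1+m,1+k] m k))) ⟩
  g 0 * (N 0 + N 0 + N 1) + sumBelow (suc m) (λ k → g (suc k) * (N k + N (suc k) + N (suc (suc k))))
    ≡⟨ cong (g 0 * (N 0 + N 0 + N 1) +_)
            (trans (sumBelow-cong (suc m) (λ k → distrib₃ (g (suc k)) (N k) (N (suc k)) (N (suc (suc k)))))
                   (sumBelow-distrib-+₃ (suc m) X Y Z)) ⟩
  g 0 * (N 0 + N 0 + N 1) + (sumBelow (suc m) X + sumBelow (suc m) Y + sumBelow (suc m) Z)
    ≡⟨ regroup (g 0) (N 0) (N 1) (sumBelow (suc m) X) (sumBelow (suc m) Y) (sumBelow (suc m) Z) ⟩
  sumBelow (suc m) X + (g 0 * N 0 + sumBelow (suc m) Y)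
    + (g 0 * N 0 + (g 0 * N 1 + sumBelow (suc m) Z))
    ≡⟨ cong₂ _+_ (cong (sumByPeak m (g ∘ suc) +_) (sumByPeak-widen {m} g (n≤1+n _)))
                 (sumByPeak-widen {m} (g ∘ pred) (≤-trans (n≤1+n _) (n≤1+n _))) ⟩
  sumByPeak m (g ∘ suc) + sumByPeak m g + sumByPeak m (g ∘ pred) ∎
  where
  N X Y Z : ℕ → ℕ
  N = peakCount m
  X k = g (suc k) * N k
  Y k = g (suc k) * N (suc k)
  Z k = g (suc k) * N (suc (suc k))
  distrib₃ : ∀ a x y z → a * (x + y + z) ≡ a * x + a * y + a * z
  distrib₃ = solve-∀
  regroup : ∀ g₀ n₀ n₁ x y z →
    g₀ * (n₀ + n₀ + n₁) + (x + y + z) ≡ x + (g₀ * n₀ + y) + (g₀ * n₀ + (g₀ * n₁ + z))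
  regroup = solve-∀

⌊n/2⌋<m⇒n<m+m : ∀ n {m} → ⌊ n /2⌋ < m → n < m + m
⌊n/2⌋<m⇒n<m+m zero          {suc m} _ = s≤s z≤n
⌊n/2⌋<m⇒n<m+m (suc zero)    {suc m} _ = s≤s (≤-trans (s≤s z≤n) (m≤n+m (suc m) m))
⌊n/2⌋<m⇒n<m+m (suc (suc n)) {suc m} (s≤s ⌊n/2⌋<m) =
  subst (suc (suc n) <_) (sym (cong suc (+-suc m m))) (s≤s (s≤s (⌊n/2⌋<m⇒n<m+m n ⌊n/2⌋<m)))

S-term : ℕ → ℕ → ℕ → ℕ
S-term m k i = (m C (k + i)) * ((m ∸ k ∸ i) C i) + (m C (k + 1 + i)) * ((m ∸ k ∸ i ∸ 1) C i)

S-term≡trinomials : ∀ m k i → S-term m k i ≡ trinomial m (k + i) i + trinomial m (suc k + i) i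
S-term≡trinomials m k i = cong₂ _+_
  (cong (λ x → (m C (k + i)) * (x C i)) (∸-+-assoc m k i))
  (cong₂ (λ u x → (m C u) * (x C i)) (cong (_+ i) (+-comm k 1)) (begin
    m ∸ k ∸ i ∸ 1     ≡⟨ ∸-+-assoc (m ∸ k) i 1 ⟩
    m ∸ k ∸ (i + 1)   ≡⟨ ∸-+-assoc m k (i + 1) ⟩
    m ∸ (k + (i + 1)) ≡⟨ cong (m ∸_) (trans (cong (k +_) (+-comm i 1)) (+-suc k i)) ⟩
    m ∸ (suc k + i)   ∎))

-- Beyond i = ⌊(m - k)/2⌋ the walks would need more than m steps.
peakCount-formula : ∀ m k → sumUpTo ⌊ (m ∸ k) /2⌋ (S-term m k) ≡ peakCount m k
peakCount-formula m k = begin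
  sumUpTo h (S-term m k)         ≡⟨ sumUpTo≡sumBelow h (S-term m k) ⟩
  sumBelow (suc h) (S-term m k)  ≡⟨ sumBelow-cong (suc h) (S-term≡trinomials m k) ⟩
  sumBelow (suc h) T             ≡⟨ sumBelow-truncate T (s≤s h≤m) T-vanish ⟨
  sumBelow (suc m) T             ≡⟨ sumBelow-distrib-+ (suc m) (λ i → trinomial m (k + i) i)
                                                               (λ i → trinomial m (suc k + i) i) ⟩
  peakCount m k                  ∎
  where
  h = ⌊ (m ∸ k) /2⌋
  h≤m : h ≤ m
  h≤m = ≤-trans (⌊n/2⌋≤n (m ∸ k)) (m∸n≤m m k)
  T : ℕ → ℕ
  T i = trinomial m (k + i) i + trinomial m (suc k + i) i
  T-vanish : ∀ i → suc h ≤ i → T i ≡ 0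
  T-vanish i h<i = cong₂ _+_ (trinomial-vanish i m<k+i+i)
    (trinomial-vanish i (≤-trans m<k+i+i (+-monoˡ-≤ i (n≤1+n (k + i)))))
    where
    m<k+i+i : m < k + i + i
    m<k+i+i = subst (m <_) (sym (+-assoc k i i))
      (≤-<-trans (m≤n+m∸n m k) (+-monoʳ-< k (⌊n/2⌋<m⇒n<m+m (m ∸ k) h<i)))

S≡sumByPeak : ∀ m → S m ≡ sumByPeak m (λ k → k)
S≡sumByPeak m = trans (sumUpTo≡sumBelow m (λ k → k * sumUpTo ⌊ (m ∸ k) /2⌋ (S-term m k)))
  (sumBelow-cong (suc m) (λ k → cong (k *_) (peakCount-formula m k)))

-- Walks

data Step : Set where
  up flat down : Step

steps : List Step
steps = up ∷ flat ∷ down ∷ []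

rise : Step → ℤ
rise up   = +[1+ 0 ]
rise flat = +0
rise down = -[1+ 0 ]

walks : (m : ℕ) → List (Vec Step m)
walks zero    = [ [] ]
walks (suc m) = cartesianProductWith _∷_ steps (walks m)

height : ∀ {m} → Vec Step m → Fin (suc m) → ℤ
height ss       zero    = +0
height (s ∷ ss) (suc i) = rise s ℤ.+ height ss i

-- peak (s ∷ ss) = max 0 (rise s + peak ss): the largest value of height (s ∷ ss).
peak : ∀ {m} → Vec Step m → ℕ
peak []          = 0
peak (up   ∷ ss) = suc (peak ss)
peak (flat ∷ ss) = peak ss
peak (down ∷ ss) = pred (peak ss)

mirror : ∀ {m} → Vec Step m → Vec Step m
mirror []          = []
mirror (up   ∷ ss) = down ∷ mirror ss
mirror (flat ∷ ss) = flat ∷ mirror ss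
mirror (down ∷ ss) = up   ∷ mirror ss

trough : ∀ {m} → Vec Step m → ℕ
trough ss = peak (mirror ss)

∈-steps : ∀ s → s ∈ steps
∈-steps up   = here refl
∈-steps flat = there (here refl)
∈-steps down = there (there (here refl))

∈-walks : ∀ {m} (ss : Vec Step m) → ss ∈ walks m
∈-walks []       = here refl
∈-walks (s ∷ ss) = ∈-cartesianProductWith⁺ _∷_ (∈-steps s) (∈-walks ss)

walks-unique : ∀ m → Unique (walks m)
walks-unique zero    = [] ∷ []
walks-unique (suc m) = Unique.cartesianProductWith⁺ _∷_ ∷-injective steps-unique (walks-unique m)
  where
  steps-unique : Unique steps
  steps-unique = ((λ ()) ∷ (λ ()) ∷ []) ∷ ((λ ()) ∷ []) ∷ [] ∷ []

sumWalks : (m : ℕ) → (Vec Step m → ℕ) → ℕ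
sumWalks m F = sum (map F (walks m))

sum-map-++ : ∀ {A : Set} (F : A → ℕ) xs ys →
  sum (map F (xs ++ ys)) ≡ sum (map F xs) + sum (map F ys)
sum-map-++ F xs ys = trans (cong sum (map-++ F xs ys)) (sum-++ (map F xs) (map F ys))

sum-map-cartesianProductWith : ∀ {A B C : Set} (F : C → ℕ) (f : A → B → C) xs ys →
  sum (map F (cartesianProductWith f xs ys)) ≡ sum (map (λ x → sum (map (F ∘ f x) ys)) xs)
sum-map-cartesianProductWith F f []       ys = refl
sum-map-cartesianProductWith F f (x ∷ xs) ys = begin
  sum (map F (map (f x) ys ++ cartesianProductWith f xs ys))
    ≡⟨ sum-map-++ F (map (f x) ys) _ ⟩
  sum (map F (map (f x) ys)) + sum (map F (cartesianProductWith f xs ys))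
    ≡⟨ cong₂ _+_ (cong sum (sym (map-∘ ys))) (sum-map-cartesianProductWith F f xs ys) ⟩
  sum (map (F ∘ f x) ys) + sum (map (λ x → sum (map (F ∘ f x) ys)) xs) ∎

sumWalks-suc : ∀ m F → sumWalks (suc m) F
  ≡ sumWalks m (F ∘ (up ∷_)) + sumWalks m (F ∘ (flat ∷_)) + sumWalks m (F ∘ (down ∷_))
sumWalks-suc m F = trans (sum-map-cartesianProductWith F _∷_ steps (walks m))
  (trans (cong (λ x → U + (L + x)) (+-identityʳ D)) (sym (+-assoc U L D)))
  where
  U = sumWalks m (F ∘ (up ∷_))
  L = sumWalks m (F ∘ (flat ∷_))
  D = sumWalks m (F ∘ (down ∷_))

sumWalks-cong : ∀ m {F G : Vec Step m → ℕ} → (∀ ss → F ss ≡ G ss) → sumWalks m F ≡ sumWalks m G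
sumWalks-cong m F≗G = cong sum (map-cong F≗G (walks m))

sum-map-+ : ∀ {A : Set} (F G : A → ℕ) xs →
  sum (map (λ x → F x + G x) xs) ≡ sum (map F xs) + sum (map G xs)
sum-map-+ F G []       = refl
sum-map-+ F G (x ∷ xs) = trans (cong (F x + G x +_) (sum-map-+ F G xs))
                               (interchange (F x) (G x) _ _)

sum-map-suc : ∀ {A : Set} (F : A → ℕ) xs → sum (map (suc ∘ F) xs) ≡ length xs + sum (map F xs)
sum-map-suc F []       = refl
sum-map-suc F (x ∷ xs) =
  cong suc (trans (cong (F x +_) (sum-map-suc F xs)) (x∙yz≈y∙xz (F x) (length xs) _))

length-cartesianProductWith : ∀ {A B C : Set} (f : A → B → C) xs ys →
  length (cartesianProductWith f xs ys) ≡ length xs * length ys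
length-cartesianProductWith f []       ys = refl
length-cartesianProductWith f (x ∷ xs) ys = begin
  length (map (f x) ys ++ cartesianProductWith f xs ys)
    ≡⟨ length-++ (map (f x) ys) ⟩
  length (map (f x) ys) + length (cartesianProductWith f xs ys)
    ≡⟨ cong₂ _+_ (length-map (f x) ys) (length-cartesianProductWith f xs ys) ⟩
  length ys + length xs * length ys ∎

length-walks : ∀ m → length (walks m) ≡ 3 ^ m
length-walks zero    = refl
length-walks (suc m) = trans (length-cartesianProductWith _∷_ steps (walks m))
                             (cong (3 *_) (length-walks m))

sumWalks-mirror : ∀ m F → sumWalks m (F ∘ mirror) ≡ sumWalks m F
sumWalks-mirror zero    F = refl
sumWalks-mirror (suc m) F = begin
  sumWalks (suc m) (F ∘ mirror)
    ≡⟨ sumWalks-suc m (F ∘ mirror) ⟩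
  mirrored (down ∷_) + mirrored (flat ∷_) + mirrored (up ∷_)
    ≡⟨ cong₂ _+_ (cong₂ _+_ (sumWalks-mirror m _) (sumWalks-mirror m _)) (sumWalks-mirror m _) ⟩
  part (down ∷_) + part (flat ∷_) + part (up ∷_)
    ≡⟨ xy∙z≈zy∙x (part (down ∷_)) (part (flat ∷_)) (part (up ∷_)) ⟩
  part (up ∷_) + part (flat ∷_) + part (down ∷_)
    ≡⟨ sumWalks-suc m F ⟨
  sumWalks (suc m) F ∎
  where
  part mirrored : (Vec Step m → Vec Step (suc m)) → ℕ
  part     g = sumWalks m (F ∘ g)
  mirrored g = sumWalks m (F ∘ g ∘ mirror)

sumWalks-peak : ∀ m g → sumWalks m (g ∘ peak) ≡ sumByPeak m g
sumWalks-peak zero    g = cong (_+ 0) (sym (*-identityʳ (g 0)))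
sumWalks-peak (suc m) g = begin
  sumWalks (suc m) (g ∘ peak)
    ≡⟨ sumWalks-suc m (g ∘ peak) ⟩
  sumWalks m (g ∘ suc ∘ peak) + sumWalks m (g ∘ peak) + sumWalks m (g ∘ pred ∘ peak)
    ≡⟨ cong₂ _+_ (cong₂ _+_ (sumWalks-peak m (g ∘ suc)) (sumWalks-peak m g))
                 (sumWalks-peak m (g ∘ pred)) ⟩
  sumByPeak m (g ∘ suc) + sumByPeak m g + sumByPeak m (g ∘ pred)
    ≡⟨ sumByPeak-suc m g ⟨
  sumByPeak (suc m) g ∎

-- The range of a height profile

-- InRange ss z is - trough ss ≤ z ≤ peak ss, split along the two constructors of ℤ.
InRange : ∀ {m} → Vec Step m → ℤ → Set
InRange ss (ℤ.+ n)  = n ≤ peak ss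
InRange ss -[1+ n ] = suc n ≤ trough ss

inRange-∷ : ∀ {m} s (ss : Vec Step m) w → InRange ss w → InRange (s ∷ ss) (rise s ℤ.+ w)
inRange-∷ up   ss (ℤ.+ n)        n≤p   = s≤s n≤p
inRange-∷ up   ss -[1+ zero ]    _     = z≤n
inRange-∷ up   ss -[1+ suc n ]   n<t   = pred-mono-≤ n<t
inRange-∷ flat ss (ℤ.+ n)        n≤p   = n≤p
inRange-∷ flat ss -[1+ n ]       n<t   = n<t
inRange-∷ down ss (ℤ.+ zero)     _     = s≤s z≤n
inRange-∷ down ss (ℤ.+ (suc n))  n<p   = pred-mono-≤ n<p
inRange-∷ down ss -[1+ n ]       n<t   = s≤s n<t

height-inRange : ∀ {m} (ss : Vec Step m) i → InRange ss (height ss i)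
height-inRange ss       zero    = z≤n
height-inRange (s ∷ ss) (suc i) = inRange-∷ s ss (height ss i) (height-inRange ss i)

height-∷ : ∀ {m} s {ss : Vec Step m} {w} →
  ∃ (λ i → height ss i ≡ w) → ∃ λ i → height (s ∷ ss) i ≡ rise s ℤ.+ w
height-∷ s (i , hᵢ≡w) = suc i , cong (ℤ._+_ (rise s)) hᵢ≡w

suc≤pred⇒2+≤ : ∀ {n k} → suc n ≤ pred k → suc (suc n) ≤ k
suc≤pred⇒2+≤ {k = suc k} = s≤s

inRange⇒height : ∀ {m} (ss : Vec Step m) z → InRange ss z → ∃ λ i → height ss i ≡ z
inRange⇒height ss          (ℤ.+ zero)    _         = zero , refl
inRange⇒height (up   ∷ ss) (ℤ.+ (suc n)) (s≤s n≤p) =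
  height-∷ up (inRange⇒height ss (ℤ.+ n) n≤p)
inRange⇒height (up   ∷ ss) -[1+ n ]      n<t       =
  height-∷ up (inRange⇒height ss -[1+ suc n ] (suc≤pred⇒2+≤ n<t))
inRange⇒height (flat ∷ ss) (ℤ.+ (suc n)) n<p       =
  height-∷ flat (inRange⇒height ss (ℤ.+ suc n) n<p)
inRange⇒height (flat ∷ ss) -[1+ n ]      n<t       =
  height-∷ flat (inRange⇒height ss -[1+ n ] n<t)
inRange⇒height (down ∷ ss) (ℤ.+ (suc n)) n<p       =
  height-∷ down (inRange⇒height ss (ℤ.+ suc (suc n)) (suc≤pred⇒2+≤ n<p))
inRange⇒height (down ∷ ss) -[1+ zero ]   _         =
  height-∷ down (inRange⇒height ss +0 z≤n)
inRange⇒height (down ∷ ss) -[1+ suc n ]  (s≤s n<t) =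
  height-∷ down (inRange⇒height ss -[1+ n ] n<t)

rangeList : ∀ {m} → Vec Step m → List ℤ
rangeList ss = map ℤ.+_ (upTo (suc (peak ss))) ++ map -[1+_] (upTo (trough ss))

rangeList-unique : ∀ {m} (ss : Vec Step m) → Unique (rangeList ss)
rangeList-unique ss = Unique.++⁺ (Unique.map⁺ (λ { refl → refl }) (Unique.upTo⁺ _))
                                 (Unique.map⁺ (λ { refl → refl }) (Unique.upTo⁺ _))
                                 nonneg-neg-disjoint
  where
  nonneg-neg-disjoint : Disjoint (map ℤ.+_ (upTo (suc (peak ss)))) (map -[1+_] (upTo (trough ss)))
  nonneg-neg-disjoint (p , q) with ∈-map⁻ ℤ.+_ p | ∈-map⁻ -[1+_] q
  ... | _ , _ , refl | _ , _ , ()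

∈-rangeList⁻ : ∀ {m} (ss : Vec Step m) {z} → z ∈ rangeList ss → InRange ss z
∈-rangeList⁻ ss z∈ with ∈-++⁻ (map ℤ.+_ (upTo (suc (peak ss)))) z∈
... | inj₁ z∈₊ with ∈-map⁻ ℤ.+_ z∈₊
...   | _ , n∈ , refl = ≤-pred (∈-upTo⁻ n∈)
∈-rangeList⁻ ss z∈ | inj₂ z∈₋ with ∈-map⁻ -[1+_] z∈₋
...   | _ , n∈ , refl = ∈-upTo⁻ n∈

∈-rangeList⁺ : ∀ {m} (ss : Vec Step m) z → InRange ss z → z ∈ rangeList ss
∈-rangeList⁺ ss (ℤ.+ n)  n≤p = ∈-++⁺ˡ (∈-map⁺ ℤ.+_ (∈-upTo⁺ (s≤s n≤p)))
∈-rangeList⁺ ss -[1+ n ] n<t =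
  ∈-++⁺ʳ (map ℤ.+_ (upTo (suc (peak ss)))) (∈-map⁺ -[1+_] (∈-upTo⁺ n<t))

length-rangeList : ∀ {m} (ss : Vec Step m) → length (rangeList ss) ≡ suc (peak ss + trough ss)
length-rangeList ss = begin
  length (map ℤ.+_ (upTo (suc (peak ss))) ++ map -[1+_] (upTo (trough ss)))
    ≡⟨ length-++ (map ℤ.+_ (upTo (suc (peak ss)))) ⟩
  length (map ℤ.+_ (upTo (suc (peak ss)))) + length (map -[1+_] (upTo (trough ss)))
    ≡⟨ cong₂ _+_ (trans (length-map ℤ.+_ (upTo (suc (peak ss)))) (length-upTo (suc (peak ss))))
                 (trans (length-map -[1+_] (upTo (trough ss))) (length-upTo (trough ss))) ⟩
  suc (peak ss + trough ss) ∎

unique∧set⇒↭ : ∀ {A : Set} {xs ys : List A} → Unique xs → Unique ys →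
  (∀ {x} → x ∈ xs → x ∈ ys) → (∀ {x} → x ∈ ys → x ∈ xs) → xs ↭ ys
unique∧set⇒↭ xs! ys! to from = ∼bag⇒↭ (unique∧set⇒bag xs! ys! (mk⇔ to from))

rng-height : ∀ {m} (ss : Vec Step m) → rng m (height ss) ≡ suc (peak ss + trough ss)
rng-height {m} ss = begin
  length (deduplicate ℤ._≟_ values)
    ≡⟨ ↭.↭-length (unique∧set⇒↭ (deduplicate-! ℤ._≟_ values) (rangeList-unique ss) to from) ⟩
  length (rangeList ss)
    ≡⟨ length-rangeList ss ⟩
  suc (peak ss + trough ss) ∎
  where
  values : List ℤ
  values = map (height ss) (allFin (suc m))
  to : ∀ {z} → z ∈ deduplicate ℤ._≟_ values → z ∈ rangeList ss
  to z∈ with ∈-map⁻ (height ss) {xs = allFin (suc m)} (∈-deduplicate⁻ ℤ._≟_ values z∈)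
  ... | i , _ , refl = ∈-rangeList⁺ ss (height ss i) (height-inRange ss i)
  from : ∀ {z} → z ∈ rangeList ss → z ∈ deduplicate ℤ._≟_ values
  from {z} z∈ with inRange⇒height ss z (∈-rangeList⁻ ss z∈)
  ... | i , refl = ∈-deduplicate⁺ ℤ._≟_ (∈-map⁺ (height ss) (∈-allFin i))

-- Height profiles are exactly the 1-Lipschitz maps

[c+a]-[c+b]≡a-b : ∀ c a b → (c ℤ.+ a) - (c ℤ.+ b) ≡ a - b
[c+a]-[c+b]≡a-b = ℤ-solve-∀

[a-c]-[b-c]≡a-b : ∀ a b c → (a - c) - (b - c) ≡ a - b
[a-c]-[b-c]≡a-b = ℤ-solve-∀

a≡c+[a-c] : ∀ a c → a ≡ c ℤ.+ (a - c)
a≡c+[a-c] = ℤ-solve-∀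

height-edge : ∀ {m} (ss : Vec Step m) (i : Fin m) →
  ∣ height ss (inject₁ i) - height ss (suc i) ∣ ≤ 1
height-edge (up   ∷ ss) zero    = s≤s z≤n
height-edge (flat ∷ ss) zero    = z≤n
height-edge (down ∷ ss) zero    = s≤s z≤n
height-edge (s    ∷ ss) (suc i)
  rewrite [c+a]-[c+b]≡a-b (rise s) (height ss (inject₁ i)) (height ss (suc i)) = height-edge ss i

height-isLip1 : ∀ {m} (ss : Vec Step m) → IsLip1 m (height ss)
height-isLip1 ss = refl , height-edge ss

rise-surjective : ∀ d → ∣ +0 - d ∣ ≤ 1 → ∃ λ s → rise s ≡ d
rise-surjective +0               _           = flat , refl
rise-surjective +[1+ zero ]      _           = up , refl
rise-surjective +[1+ suc n ]     (s≤s ())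
rise-surjective -[1+ zero ]      _           = down , refl
rise-surjective -[1+ suc n ]     (s≤s ())

tail-isLip1 : ∀ {m} f s → IsLip1 (suc m) f → rise s ≡ f (suc zero) →
  IsLip1 m (λ i → f (suc i) - rise s)
tail-isLip1 f s (_ , lip) rise≡f₁ =
  trans (cong (_- rise s) (sym rise≡f₁)) (ℤP.+-inverseʳ (rise s)) ,
  λ i → subst (_≤ 1)
              (cong ∣_∣ (sym ([a-c]-[b-c]≡a-b (f (suc (inject₁ i))) (f (suc (suc i))) (rise s))))
              (lip (suc i))

lipschitz⇒height : ∀ m f → IsLip1 m f → ∃ λ ss → f ≗f height ss
lipschitz⇒height zero    f (f₀ , _)   = [] , λ { zero → f₀ }
lipschitz⇒height (suc m) f f-lip@(f₀ , lip)
  with rise-surjective (f (suc zero)) (subst (λ x → ∣ x - f (suc zero) ∣ ≤ 1) f₀ (lip zero))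
... | s , rise≡f₁ with lipschitz⇒height m _ (tail-isLip1 f s f-lip rise≡f₁)
...   | ss , f₊-rise≗ = s ∷ ss , λ where
  zero    → f₀
  (suc i) → trans (a≡c+[a-c] (f (suc i)) (rise s)) (cong (ℤ._+_ (rise s)) (f₊-rise≗ i))

rise-injective : ∀ {s t} → rise s ≡ rise t → s ≡ t
rise-injective {up}   {up}   _ = refl
rise-injective {flat} {flat} _ = refl
rise-injective {down} {down} _ = refl
rise-injective {up}   {flat} ()
rise-injective {up}   {down} ()
rise-injective {flat} {up}   ()
rise-injective {flat} {down} ()
rise-injective {down} {up}   ()
rise-injective {down} {flat} ()

height-injective : ∀ {m} {a b : Vec Step m} → height a ≗f height b → a ≡ b
height-injective {a = []}    {[]}    _ = refl
height-injective {a = s ∷ a} {t ∷ b} a≗b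
  with rise-injective (trans (sym (ℤP.+-identityʳ (rise s)))
                             (trans (a≗b (suc zero)) (ℤP.+-identityʳ (rise t))))
... | refl = cong (s ∷_) (height-injective (λ i → ∙-cancelˡ (rise s) _ _ (a≗b (suc i))))

heights : (m : ℕ) → List (Fin (suc m) → ℤ)
heights m = map height (walks m)

heights-enumerate : ∀ m → Enumerates m (heights m)
heights-enumerate m =
  All.map⁺ (All.universal height-isLip1 (walks m)) ,
  (λ f f-lip → let ss , f≗ = lipschitz⇒height m f f-lip in
               Any.map⁺ (Any.map (λ { refl → f≗ }) (∈-walks ss))) ,
  AllPairs.map⁺ (AllPairs.map (λ a≢b a≗b → a≢b (height-injective a≗b)) (walks-unique m))

length-heights : ∀ m → length (heights m) ≡ 3 ^ m
length-heights m = trans (length-map height (walks m)) (length-walks m)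

sum-rng-heights : ∀ m → sum (map (rng m) (heights m)) ≡ 3 ^ m + 2 * S m
sum-rng-heights m = begin
  sum (map (rng m) (map height (walks m)))
    ≡⟨ cong sum (sym (map-∘ (walks m))) ⟩
  sumWalks m (rng m ∘ height)
    ≡⟨ sumWalks-cong m rng-height ⟩
  sumWalks m (λ ss → suc (peak ss + trough ss))
    ≡⟨ sum-map-suc (λ ss → peak ss + trough ss) (walks m) ⟩
  length (walks m) + sumWalks m (λ ss → peak ss + trough ss)
    ≡⟨ cong₂ _+_ (length-walks m) (sum-map-+ peak trough (walks m)) ⟩
  3 ^ m + (sumWalks m peak + sumWalks m (peak ∘ mirror))
    ≡⟨ cong (λ x → 3 ^ m + (sumWalks m peak + x)) (sumWalks-mirror m peak) ⟩
  3 ^ m + (sumWalks m peak + sumWalks m peak)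
    ≡⟨ cong (λ x → 3 ^ m + (x + x)) (trans (sumWalks-peak m (λ k → k)) (sym (S≡sumByPeak m))) ⟩
  3 ^ m + (S m + S m)
    ≡⟨ cong (3 ^ m +_) (cong (S m +_) (sym (+-identityʳ (S m)))) ⟩
  3 ^ m + 2 * S m ∎

-- All enumerations of the 1-Lipschitz maps agree

tabulate-injective : ∀ {A : Set} {n} {f g : Fin n → A} → tabulate f ≡ tabulate g → ∀ i → f i ≡ g i
tabulate-injective {f = f} {g} tf≡tg i =
  trans (sym (lookup∘tabulate f i)) (trans (cong (λ v → lookup v i) tf≡tg) (lookup∘tabulate g i))

-- Maps are compared through their tables, which turns ≗f into ≡.
tabulates-unique : ∀ {m} {L : List (Fin (suc m) → ℤ)} → Enumerates m L → Unique (map tabulate L)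
tabulates-unique (_ , _ , distinct) =
  AllPairs.map⁺ (AllPairs.map (λ f≉g tf≡tg → f≉g (tabulate-injective tf≡tg)) distinct)

∈-tabulates : ∀ {m} {L L′ : List (Fin (suc m) → ℤ)} → Enumerates m L → Enumerates m L′ →
  ∀ {v} → v ∈ map tabulate L → v ∈ map tabulate L′
∈-tabulates (lipschitz , _ , _) (_ , complete′ , _) v∈ with ∈-map⁻ tabulate v∈
... | f , f∈L , refl = Any.map⁺ (Any.map tabulate-cong (complete′ f (All.lookup lipschitz f∈L)))

enumerations-↭ : ∀ {m} {L L′ : List (Fin (suc m) → ℤ)} → Enumerates m L → Enumerates m L′ →
  map tabulate L ↭ map tabulate L′
enumerations-↭ E E′ =
  unique∧set⇒↭ (tabulates-unique E) (tabulates-unique E′) (∈-tabulates E E′) (∈-tabulates E′ E)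

length-enumerations : ∀ {m} {L L′ : List (Fin (suc m) → ℤ)} → Enumerates m L → Enumerates m L′ →
  length L ≡ length L′
length-enumerations {L = L} {L′} E E′ = begin
  length L                   ≡⟨ length-map tabulate L ⟨
  length (map tabulate L)    ≡⟨ ↭.↭-length (enumerations-↭ E E′) ⟩
  length (map tabulate L′)   ≡⟨ length-map tabulate L′ ⟩
  length L′                  ∎

sum-map-enumerations : ∀ {m} {L L′ : List (Fin (suc m) → ℤ)} (h : (Fin (suc m) → ℤ) → ℕ) →
  (∀ {f g} → f ≗f g → h f ≡ h g) → Enumerates m L → Enumerates m L′ →
  sum (map h L) ≡ sum (map h L′)
sum-map-enumerations {L = L} {L′} h h-cong E E′ = begin
  sum (map h L)                            ≡⟨ via-tabulate L ⟩
  sum (map (h ∘ lookup) (map tabulate L))  ≡⟨ sum-↭ (↭.map⁺ (h ∘ lookup) (enumerations-↭ E E′)) ⟩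
  sum (map (h ∘ lookup) (map tabulate L′)) ≡⟨ via-tabulate L′ ⟨
  sum (map h L′)                           ∎
  where
  via-tabulate : ∀ xs → sum (map h xs) ≡ sum (map (h ∘ lookup) (map tabulate xs))
  via-tabulate xs = cong sum (trans (map-cong (λ f → h-cong (sym ∘ lookup∘tabulate f)) xs) (map-∘ xs))

rng-cong : ∀ m {f g : Fin (suc m) → ℤ} → f ≗f g → rng m f ≡ rng m g
rng-cong m f≗g = cong (λ xs → length (deduplicate ℤ._≟_ xs)) (map-cong f≗g (allFin (suc m)))

theorem4 : (m : ℕ) →
    ∃ (λ (L : List (Fin (suc m) → ℤ)) → Enumerates m L)
    × (∀ (L : List (Fin (suc m) → ℤ)) → Enumerates m L →
        3 ^ m * sum (map (rng m) L) ≡ length L * (3 ^ m + 2 * S m))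
theorem4 m = (heights m , heights-enumerate m) , λ L L-enum → begin
  3 ^ m * sum (map (rng m) L)
    ≡⟨ cong (3 ^ m *_) (sum-map-enumerations (rng m) (rng-cong m) L-enum (heights-enumerate m)) ⟩
  3 ^ m * sum (map (rng m) (heights m))
    ≡⟨ cong (3 ^ m *_) (sum-rng-heights m) ⟩
  3 ^ m * (3 ^ m + 2 * S m)
    ≡⟨ cong (_* (3 ^ m + 2 * S m))
            (trans (sym (length-heights m)) (length-enumerations (heights-enumerate m) L-enum)) ⟩
  length L * (3 ^ m + 2 * S m) ∎
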